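{- Let $\mathcal{T}$ be a tredoku tiling with $\tau$ tiles, $\rho$ runs and $\lambda$ leaves, and suppose its run graph has $\epsilon$ edges. Then $\tau=3\rho-\epsilon$ and $\lambda=3\rho-2\epsilon$.
   Context: A tile is a closed rhombus of unit side with interior angles $60^\circ$ and $120^\circ$, placed so that its edges lie on a fixed triangular lattice of the plane. Two tiles are adjacent if they share a full common edge. A run is a maximal sequence $T_1,\dots,T_k$ ($k\ge 2$) of distinct tiles such that $T_i$ and $T_{i+1}$ share an edge $e_i$, all the $e_i$ are parallel, and for $1<i<k$ the edges $e_{i-1},e_i$ are opposite edges of $T_i$. A tredoku tiling is a finite set of $\tau\ge5$ tiles such that: (P1) the adjacency graph on the tiles is connected; (P2) any two tiles are disjoint, meet in exactly one common vertex, or share a full common edge; (P3) after removing any single tile, the remaining tiles are still connected, where two tiles are considered joined if they have nonempty intersection; (P4/P5) every run consists of exactly three tiles; and (no holes) the complement of the union of the tiles is connected. A leaf is a tile lying in exactly one run. The run graph of the tiling is the simple graph whose vertices are the runs, with an edge joining two distinct runs whenever they have a tile in common. -}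

module Defs where

open import Data.Nat using (ℕ; _≤_; _≡ᵇ_)
open import Data.Integer as ℤ using (ℤ; +_; -[1+_]) renaming (_+_ to _+ℤ_)
import Data.Integer.Properties as ℤP
open import Data.Bool using (Bool)
open import Data.Product using (Σ; ∃; ∃₂; _×_; _,_; proj₁; proj₂)
open import Data.Product.Properties using (≡-dec)
open import Data.Sum using (_⊎_)
open import Data.List using (List; []; _∷_; _++_; length; map; filterᵇ; reverse)
open import Data.List.Membership.Propositional using (_∈_)
import Data.List.Membership.DecPropositional as DecMem
open import Data.List.Relation.Unary.Any using (Any; any?)
open import Data.List.Relation.Unary.All using (All)
open import Data.List.Relation.Unary.AllPairs using (AllPairs)
open import Data.List.Relation.Unary.Unique.Propositional using (Unique)
open import Relation.Binary.PropositionalEquality using (_≡_; _≢_; refl)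
open import Relation.Binary.Construct.Closure.ReflexiveTransitive using (Star)
open import Relation.Binary.Definitions using (DecidableEquality)
open import Relation.Nullary using (¬_; yes; no; does)
open import Function.Bundles using (_⇔_)

-- The triangular lattice, in lattice coordinates.
-- A point (i , j) stands for i·a + j·b where a = (1,0), b = (1/2, √3/2).
-- The three lattice unit directions are a, b and c = b - a.

Pt : Set
Pt = ℤ × ℤ

_⊕_ : Pt → Pt → Pt
(i , j) ⊕ (k , l) = (i +ℤ k , j +ℤ l)

data Dir : Set where
  dA dB dC : Dir

vec : Dir → Pt
vec dA = (+ 1 , + 0)
vec dB = (+ 0 , + 1)
vec dC = (-[1+ 0 ] , + 1)

-- A lattice edge (unit segment) from p to p ⊕ vec d; every unit segment of
-- the lattice has exactly one such representation.
Edge : Set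
Edge = Pt × Dir

dirOf : Edge → Dir
dirOf = proj₂

-- The open cells of the triangular lattice; the plane is the disjoint
-- union of these open cells.

data Cell : Set where
  vtx : Pt → Cell
  edg : Edge → Cell
  up  : Pt → Cell          -- open triangle p, p+a, p+b
  dn  : Pt → Cell          -- open triangle p+a, p+b, p+a+b

data Face : Cell → Cell → Set where
  e-v₁ : ∀ {p d} → Face (vtx p) (edg (p , d))
  e-v₂ : ∀ {p d} → Face (vtx (p ⊕ vec d)) (edg (p , d))
  up-v₁ : ∀ {p} → Face (vtx p) (up p)
  up-v₂ : ∀ {p} → Face (vtx (p ⊕ vec dA)) (up p)
  up-v₃ : ∀ {p} → Face (vtx (p ⊕ vec dB)) (up p)
  up-e₁ : ∀ {p} → Face (edg (p , dA)) (up p)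
  up-e₂ : ∀ {p} → Face (edg (p , dB)) (up p)
  up-e₃ : ∀ {p} → Face (edg (p ⊕ vec dA , dC)) (up p)
  dn-v₁ : ∀ {p} → Face (vtx (p ⊕ vec dA)) (dn p)
  dn-v₂ : ∀ {p} → Face (vtx (p ⊕ vec dB)) (dn p)
  dn-v₃ : ∀ {p} → Face (vtx ((p ⊕ vec dA) ⊕ vec dB)) (dn p)
  dn-e₁ : ∀ {p} → Face (edg (p ⊕ vec dB , dA)) (dn p)
  dn-e₂ : ∀ {p} → Face (edg (p ⊕ vec dA , dB)) (dn p)
  dn-e₃ : ∀ {p} → Face (edg (p ⊕ vec dA , dC)) (dn p)

-- A rhombus with 60°/120° angles and edges on the lattice is
-- spanned at a lattice point p by two of the three directions:
--   ab : p + s·a + t·b,  bc : p + s·b + t·c,  ac : p + s·a + t·c  (s,t ∈ [0,1]).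
-- Every such tile has exactly one representation (p , o).

data Ori : Set where
  ab bc ac : Ori

Tile : Set
Tile = Pt × Ori

_≟Ori_ : DecidableEquality Ori
ab ≟Ori ab = yes refl
ab ≟Ori bc = no λ ()
ab ≟Ori ac = no λ ()
bc ≟Ori ab = no λ ()
bc ≟Ori bc = yes refl
bc ≟Ori ac = no λ ()
ac ≟Ori ab = no λ ()
ac ≟Ori bc = no λ ()
ac ≟Ori ac = yes refl

_≟Pt_ : DecidableEquality Pt
_≟Pt_ = ≡-dec ℤ._≟_ ℤ._≟_

_≟Tile_ : DecidableEquality Tile
_≟Tile_ = ≡-dec _≟Pt_ _≟Ori_

spans : Ori → Dir × Dir
spans ab = (dA , dB)
spans bc = (dB , dC)
spans ac = (dA , dC)

sides : Tile → List (Edge × Edge)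
sides (p , o) with spans o
... | (u , w) = ((p , u) , (p ⊕ vec w , u)) ∷ ((p , w) , (p ⊕ vec u , w)) ∷ []

IsEdgeOf : Edge → Tile → Set
IsEdgeOf e T = Any (λ pr → e ≡ proj₁ pr ⊎ e ≡ proj₂ pr) (sides T)

Opposite : Tile → Edge → Edge → Set
Opposite T e e' = (e , e') ∈ sides T ⊎ (e' , e) ∈ sides T

triangles : Tile → List Cell
triangles ((i , j) , ab) = up (i , j) ∷ dn (i , j) ∷ []
triangles ((i , j) , bc) = dn (i +ℤ -[1+ 0 ] , j) ∷ up (i +ℤ -[1+ 0 ] , j +ℤ + 1) ∷ []
triangles ((i , j) , ac) = up (i , j) ∷ dn (i +ℤ -[1+ 0 ] , j) ∷ []

-- The open cell c is contained in the closed tile T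
-- (the closed tile is the union of its two closed triangles).
InTile : Tile → Cell → Set
InTile T c = Any (λ t → c ≡ t ⊎ Face c t) (triangles T)

-- Points common to both closed tiles: exactly the union of the common cells.
Meet : Tile → Tile → Cell → Set
Meet T T' c = InTile T c × InTile T' c

Intersect : Tile → Tile → Set
Intersect T T' = ∃ λ c → Meet T T' c

ShareEdge : Tile → Tile → Edge → Set
ShareEdge T T' e = IsEdgeOf e T × IsEdgeOf e T'

Adjacent : Tile → Tile → Set
Adjacent T T' = T ≢ T' × ∃ λ e → ShareEdge T T' e

InClosedEdge : Edge → Cell → Set
InClosedEdge e c = c ≡ edg e ⊎ c ≡ vtx (proj₁ e) ⊎ c ≡ vtx (proj₁ e ⊕ vec (proj₂ e))

IsVertexOf : Pt → Tile → Set
IsVertexOf v (p , o) with spans o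
... | (u , w) = v ≡ p ⊎ v ≡ p ⊕ vec u ⊎ v ≡ p ⊕ vec w ⊎ v ≡ (p ⊕ vec u) ⊕ vec w

P1 : List Tile → Set
P1 ts = ∀ {x y} → x ∈ ts → y ∈ ts →
  Star (λ u v → u ∈ ts × v ∈ ts × Adjacent u v) x y

P2 : List Tile → Set
P2 ts = ∀ {x y} → x ∈ ts → y ∈ ts → x ≢ y →
    (∀ c → ¬ Meet x y c)
  ⊎ (∃ λ v → IsVertexOf v x × IsVertexOf v y × (∀ c → Meet x y c ⇔ c ≡ vtx v))
  ⊎ (∃ λ e → ShareEdge x y e × (∀ c → Meet x y c ⇔ InClosedEdge e c))

P3 : List Tile → Set
P3 ts = ∀ {t x y} → t ∈ ts → x ∈ ts → y ∈ ts → x ≢ t → y ≢ t →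
  Star (λ u v → u ∈ ts × v ∈ ts × u ≢ t × v ≢ t × Intersect u v) x y

data Chain (d : Dir) : Edge → List Tile → Set where
  two  : ∀ {T T' e} → ShareEdge T T' e → dirOf e ≡ d → Chain d e (T ∷ T' ∷ [])
  cons : ∀ {T T' e e' rest} → ShareEdge T T' e → dirOf e ≡ d →
         Opposite T' e e' → Chain d e' (T' ∷ rest) → Chain d e (T ∷ T' ∷ rest)

PreRun : List Tile → List Tile → Set
PreRun ts xs = All (_∈ ts) xs × Unique xs × ∃₂ λ d e → Chain d e xs

IsRun : List Tile → List Tile → Set
IsRun ts xs = PreRun ts xs ×
  (∀ as bs → PreRun ts (as ++ xs ++ bs) → as ≡ [] × bs ≡ [])

P45 : List Tile → Set
P45 ts = ∀ xs → IsRun ts xs → length xs ≡ 3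

-- (no holes) the complement of the union of the tiles is connected.
-- The complement is a union of open cells; it is connected iff its cells
-- are connected under the face relation.
Uncovered : List Tile → Cell → Set
Uncovered ts c = ∀ {t} → t ∈ ts → ¬ InTile t c

NoHoles : List Tile → Set
NoHoles ts = ∀ {c c'} → Uncovered ts c → Uncovered ts c' →
  Star (λ u v → Uncovered ts u × Uncovered ts v × (Face u v ⊎ Face v u)) c c'

Tredoku : List Tile → Set
Tredoku ts = Unique ts × 5 ≤ length ts × P1 ts × P2 ts × P3 ts × P45 ts × NoHoles ts

-- Runs as unordered objects: a sequence and its reverse are the same run.
-- rs enumerates the runs of ts, each exactly once.

SameRun : List Tile → List Tile → Set
SameRun xs ys = xs ≡ ys ⊎ xs ≡ reverse ys

RunEnumeration : List Tile → List (List Tile) → Set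
RunEnumeration ts rs =
  All (IsRun ts) rs ×
  (∀ xs → IsRun ts xs → Any (SameRun xs) rs) ×
  AllPairs (λ r r' → ¬ SameRun r r') rs

open DecMem _≟Tile_ using (_∈?_)

runsThrough : Tile → List (List Tile) → ℕ
runsThrough t rs = length (filterᵇ (λ r → does (t ∈? r)) rs)

leaves : List Tile → List (List Tile) → ℕ
leaves ts rs = length (filterᵇ (λ t → runsThrough t rs ≡ᵇ 1) ts)

pairs : {A : Set} → List A → List (A × A)
pairs [] = []
pairs (x ∷ xs) = map (x ,_) xs ++ pairs xs

shareTile : List Tile → List Tile → Bool
shareTile r r' = does (any? (_∈? r') r)

runGraphEdges : List (List Tile) → ℕ
runGraphEdges rs = length (filterᵇ (λ pr → shareTile (proj₁ pr) (proj₂ pr)) (pairs rs))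

-- Every tile lies on one or two runs.  At least one: a tile has an edge-neighbour, and the
-- two of them form a chain that extends to a maximal one.  At most two: a run through a tile
-- crosses it along one of its two edge directions, and two runs with the same direction
-- through a common tile coincide.  Two distinct runs share at most one tile.  If r(t) ∈ {1,2}
-- is the number of runs through t, double counting gives Σₜ r(t) = 3ρ and Σₜ C(r(t),2) = ε,
-- whence τ + ε = 3ρ and λ + 2ε = 3ρ.
--
-- The geometric input is only that distinct tiles do not overlap (P2), and its consequences
-- used here are local: up to translation, every configuration of tiles sharing edges around a
-- fixed edge is one of finitely many, so each fact is proved by translating that edge to the
-- origin and deciding the finitely many cases by evaluation.

module Submission where

open import Defs
open import Data.Bool using (Bool; true; false; T; _∧_; _∨_)
open import Data.Bool.Properties using (T-≡)
open import Data.Empty using (⊥; ⊥-elim)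
open import Data.Integer using (+_; -_; _-_; _⊖_) renaming (_+_ to _+ℤ_)
import Data.Integer.Properties as ℤ
open import Algebra.Properties.AbelianGroup ℤ.+-0-abelianGroup using (∙-cancelˡ; //-rightDividesʳ)
open import Data.List using (List; []; _∷_; _++_; length; map; concatMap; filterᵇ)
open import Data.List.Membership.Propositional using (_∈_; find; lose)
open import Data.List.Membership.Propositional.Properties
  using (∈-map⁺; ∈-map⁻; ∈-++⁻; ∈-++⁺ˡ; ∈-++⁺ʳ; ∈-∃++; ∈-length; ∈-filter⁺;
         ∈-filter⁻)
import Data.List.Membership.DecPropositional as DecMembership
open import Data.List.Properties using (map-++; length-++-sucʳ; length-++-≤ˡ; length-++-≤ʳ)
open import Data.List.Relation.Unary.All as All using (All; []; _∷_; all?)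
open import Data.List.Relation.Unary.AllPairs using (AllPairs; []; _∷_)
open import Data.List.Relation.Unary.AllPairs.Properties using (filter⁺)
open import Data.List.Relation.Unary.Any as Any using (Any; here; there; any?)
open import Data.List.Relation.Unary.Any.Properties using (reverse⁻)
open import Data.List.Relation.Unary.Unique.Propositional using (Unique)
open import Data.Nat using (ℕ; zero; suc; _+_; _*_; _∸_; _≤_; _<_; z≤n; s≤s; _≤?_; _≡ᵇ_)
open import Data.Nat.Combinatorics using (_C_; nC1≡n; nCk+nC[k+1]≡[n+1]C[k+1])
open import Data.Nat.ListAction using (sum)
open import Data.Nat.ListAction.Properties using (sum-++)
open import Data.Nat.Properties
  using (≤-trans; ≤-reflexive; <⇒≱; m≤m+n; m≤n+m; +-suc; +-monoʳ-≤; m+n∸n≡m;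
         +-identityʳ; *-identityʳ; *-zeroʳ; *-distribˡ-+; +-commutativeSemigroup)
open import Algebra.Properties.CommutativeSemigroup +-commutativeSemigroup
  using () renaming (interchange to +-interchange)
open import Data.Product using (∃; ∃₂; _×_; _,_; proj₁; proj₂; swap)
open import Data.Product.Properties using (≡-dec)
open import Data.Sum using (_⊎_; inj₁; inj₂)
import Data.Sum as Sum
open import Function using (_∘_)
open import Function.Bundles using (Equivalence; mk⇔)
open import Relation.Binary.Construct.Closure.ReflexiveTransitive using (ε; _◅_)
open import Relation.Binary.Definitions using (DecidableEquality)
open import Relation.Binary.PropositionalEquality
  using (_≡_; _≢_; refl; sym; trans; cong; cong₂; subst; ≢-sym; module ≡-Reasoning)
open import Relation.Nullary using (¬_; Dec; yes; no; does)
open import Relation.Nullary.Decidable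
  using (map′; _×-dec_; _⊎-dec_; _→-dec_; ¬?; T?; from-yes; dec-true; dec-false; does-⇔;
         decidable-stable; ¬¬-excluded-middle)
open import Relation.Unary using (Decidable)

_≟Dir_ : DecidableEquality Dir
dA ≟Dir dA = yes refl
dA ≟Dir dB = no λ ()
dA ≟Dir dC = no λ ()
dB ≟Dir dA = no λ ()
dB ≟Dir dB = yes refl
dB ≟Dir dC = no λ ()
dC ≟Dir dA = no λ ()
dC ≟Dir dB = no λ ()
dC ≟Dir dC = yes refl

_≟Edge_ : DecidableEquality Edge
_≟Edge_ = ≡-dec _≟Pt_ _≟Dir_

_≟Cell_ : DecidableEquality Cell
vtx p ≟Cell vtx q = map′ (cong vtx) (λ { refl → refl }) (p ≟Pt q)
edg e ≟Cell edg f = map′ (cong edg) (λ { refl → refl }) (e ≟Edge f)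
up p  ≟Cell up q  = map′ (cong up) (λ { refl → refl }) (p ≟Pt q)
dn p  ≟Cell dn q  = map′ (cong dn) (λ { refl → refl }) (p ≟Pt q)
vtx _ ≟Cell edg _ = no λ ()
vtx _ ≟Cell up _  = no λ ()
vtx _ ≟Cell dn _  = no λ ()
edg _ ≟Cell vtx _ = no λ ()
edg _ ≟Cell up _  = no λ ()
edg _ ≟Cell dn _  = no λ ()
up _  ≟Cell vtx _ = no λ ()
up _  ≟Cell edg _ = no λ ()
up _  ≟Cell dn _  = no λ ()
dn _  ≟Cell vtx _ = no λ ()
dn _  ≟Cell edg _ = no λ ()
dn _  ≟Cell up _  = no λ ()

open DecMembership _≟Tile_ using (_∈?_)
open DecMembership _≟Edge_ using () renaming (_∈?_ to _∈ᵉ?_)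
open DecMembership _≟Cell_ using () renaming (_∈?_ to _∈ᶜ?_)

origin : Pt
origin = (+ 0 , + 0)

infix  25 ⊖_
infixr 5  _⊕ᵉ_ _⊕ᵗ_ _⊕ᶜ_

⊖_ : Pt → Pt
⊖ (i , j) = (- i , - j)

_⊕ᵉ_ : Pt → Edge → Edge
v ⊕ᵉ (p , d) = (v ⊕ p , d)

_⊕ᵗ_ : Pt → Tile → Tile
v ⊕ᵗ (p , o) = (v ⊕ p , o)

_⊕ᶜ_ : Pt → Cell → Cell
v ⊕ᶜ vtx p = vtx (v ⊕ p)
v ⊕ᶜ edg e = edg (v ⊕ᵉ e)
v ⊕ᶜ up p  = up (v ⊕ p)
v ⊕ᶜ dn p  = dn (v ⊕ p)

⊕-assoc : ∀ p q r → (p ⊕ q) ⊕ r ≡ p ⊕ (q ⊕ r)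
⊕-assoc (i , j) (k , l) (m , n) = cong₂ _,_ (ℤ.+-assoc i k m) (ℤ.+-assoc j l n)

⊕-identityʳ : ∀ p → p ⊕ origin ≡ p
⊕-identityʳ (i , j) = cong₂ _,_ (ℤ.+-identityʳ i) (ℤ.+-identityʳ j)

⊕-⊖-cancelʳ : ∀ p v → (p ⊕ v) ⊕ ⊖ v ≡ p
⊕-⊖-cancelʳ (i , j) (k , l) = cong₂ _,_ (//-rightDividesʳ k i) (//-rightDividesʳ l j)

⊕-cancelˡ : ∀ v {p q} → v ⊕ p ≡ v ⊕ q → p ≡ q
⊕-cancelˡ (i , j) {k , l} {m , n} eq =
  cong₂ _,_ (∙-cancelˡ i k m (cong proj₁ eq)) (∙-cancelˡ j l n (cong proj₂ eq))

⊕ᵉ-injective : ∀ v {e f} → v ⊕ᵉ e ≡ v ⊕ᵉ f → e ≡ f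
⊕ᵉ-injective v eq = cong₂ _,_ (⊕-cancelˡ v (cong proj₁ eq)) (cong proj₂ eq)

⊕ᵗ-assoc : ∀ v w T → (v ⊕ w) ⊕ᵗ T ≡ v ⊕ᵗ w ⊕ᵗ T
⊕ᵗ-assoc v w (p , o) = cong (_, o) (⊕-assoc v w p)

edges : Tile → List Edge
edges T = concatMap (λ s → proj₁ s ∷ proj₂ s ∷ []) (sides T)

∈-edges : ∀ {g T} → IsEdgeOf g T → g ∈ edges T
∈-edges {T = T} = go (sides T)
  where
  go : ∀ {g} ss → Any (λ s → g ≡ proj₁ s ⊎ g ≡ proj₂ s) ss →
       g ∈ concatMap (λ s → proj₁ s ∷ proj₂ s ∷ []) ss
  go (s ∷ ss) (here (inj₁ eq)) = here eq
  go (s ∷ ss) (here (inj₂ eq)) = there (here eq)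
  go (s ∷ ss) (there g∈)       = there (there (go ss g∈))

edges-⊕ : ∀ v T → edges (v ⊕ᵗ T) ≡ map (v ⊕ᵉ_) (edges T)
edges-⊕ v (p , ab) = cong₂ (λ q r → (v ⊕ p , dA) ∷ (q , dA) ∷ (v ⊕ p , dB) ∷ (r , dB) ∷ [])
                           (⊕-assoc v p (vec dB)) (⊕-assoc v p (vec dA))
edges-⊕ v (p , bc) = cong₂ (λ q r → (v ⊕ p , dB) ∷ (q , dB) ∷ (v ⊕ p , dC) ∷ (r , dC) ∷ [])
                           (⊕-assoc v p (vec dC)) (⊕-assoc v p (vec dB))
edges-⊕ v (p , ac) = cong₂ (λ q r → (v ⊕ p , dA) ∷ (q , dA) ∷ (v ⊕ p , dC) ∷ (r , dC) ∷ [])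
                           (⊕-assoc v p (vec dC)) (⊕-assoc v p (vec dA))

edge-of-⊕ : ∀ {g v T} → IsEdgeOf g (v ⊕ᵗ T) → ∃ λ g₀ → g₀ ∈ edges T × g ≡ v ⊕ᵉ g₀
edge-of-⊕ {g} {v} {T} g∈ =
  ∈-map⁻ (v ⊕ᵉ_) (subst (g ∈_) (edges-⊕ v T) (∈-edges {T = v ⊕ᵗ T} g∈))

⊕-edge-of-⊕ : ∀ {g v T} → IsEdgeOf (v ⊕ᵉ g) (v ⊕ᵗ T) → g ∈ edges T
⊕-edge-of-⊕ {g} {v} {T} g∈ with edge-of-⊕ {v = v} {T = T} g∈
... | g₀ , g₀∈ , eq = subst (_∈ edges T) (sym (⊕ᵉ-injective v eq)) g₀∈

tilesAround : Dir → List Tile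
tilesAround dA = (origin , ab) ∷ (⊖ vec dB , ab) ∷ (origin , ac) ∷ (⊖ vec dC , ac) ∷ []
tilesAround dB = (origin , ab) ∷ (⊖ vec dA , ab) ∷ (origin , bc) ∷ (⊖ vec dC , bc) ∷ []
tilesAround dC = (origin , bc) ∷ (⊖ vec dB , bc) ∷ (origin , ac) ∷ (⊖ vec dA , ac) ∷ []

tilesOn : Edge → List Tile
tilesOn (p , d) = map (p ⊕ᵗ_) (tilesAround d)

at-base : ∀ {p o} → (p , o) ≡ p ⊕ᵗ (origin , o)
at-base {p} {o} = cong (_, o) (sym (⊕-identityʳ p))

at-offset : ∀ {p o} v → (p , o) ≡ (p ⊕ v) ⊕ᵗ (⊖ v , o)
at-offset {p} {o} v = cong (_, o) (sym (⊕-⊖-cancelʳ p v))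

tile-on-edge₀ : ∀ {q d T} → IsEdgeOf (q , d) T → ∃ λ T₀ → T₀ ∈ tilesAround d × T ≡ q ⊕ᵗ T₀
tile-on-edge₀ {T = _ , ab} (here (inj₁ refl))         = _ , here refl , at-base
tile-on-edge₀ {T = _ , ab} (here (inj₂ refl))         = _ , there (here refl) , at-offset (vec dB)
tile-on-edge₀ {T = _ , ab} (there (here (inj₁ refl))) = _ , here refl , at-base
tile-on-edge₀ {T = _ , ab} (there (here (inj₂ refl))) = _ , there (here refl) , at-offset (vec dA)
tile-on-edge₀ {T = _ , bc} (here (inj₁ refl))         = _ , there (there (here refl)) , at-base
tile-on-edge₀ {T = _ , bc} (here (inj₂ refl))         = _ , there (there (there (here refl))) , at-offset (vec dC)
tile-on-edge₀ {T = _ , bc} (there (here (inj₁ refl))) = _ , here refl , at-base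
tile-on-edge₀ {T = _ , bc} (there (here (inj₂ refl))) = _ , there (here refl) , at-offset (vec dB)
tile-on-edge₀ {T = _ , ac} (here (inj₁ refl))         = _ , there (there (here refl)) , at-base
tile-on-edge₀ {T = _ , ac} (here (inj₂ refl))         = _ , there (there (there (here refl))) , at-offset (vec dC)
tile-on-edge₀ {T = _ , ac} (there (here (inj₁ refl))) = _ , there (there (here refl)) , at-base
tile-on-edge₀ {T = _ , ac} (there (here (inj₂ refl))) = _ , there (there (there (here refl))) , at-offset (vec dA)

tile-on-edge : ∀ {v e T} → IsEdgeOf (v ⊕ᵉ e) T → ∃ λ T₀ → T₀ ∈ tilesOn e × T ≡ v ⊕ᵗ T₀
tile-on-edge {v} {p , d} {T} g∈ with tile-on-edge₀ {T = T} g∈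
... | T₁ , T₁∈ , refl = p ⊕ᵗ T₁ , ∈-map⁺ (p ⊕ᵗ_) T₁∈ , ⊕ᵗ-assoc v p T₁

triangles-⊕ : ∀ v T → triangles (v ⊕ᵗ T) ≡ map (v ⊕ᶜ_) (triangles T)
triangles-⊕ (k , l) ((i , j) , ab) = refl
triangles-⊕ (k , l) ((i , j) , bc) =
  cong₂ (λ x y → dn (x , l +ℤ j) ∷ up (x , y) ∷ [])
        (ℤ.+-assoc k i (- + 1)) (ℤ.+-assoc l j (+ 1))
triangles-⊕ (k , l) ((i , j) , ac) =
  cong (λ x → up (k +ℤ i , l +ℤ j) ∷ dn (x , l +ℤ j) ∷ [])
       (ℤ.+-assoc k i (- + 1))

Overlap : Tile → Tile → Set
Overlap X Y = ∃ λ c → c ∈ triangles X × c ∈ triangles Y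

overlap? : ∀ X Y → Dec (Overlap X Y)
overlap? X Y = map′ find (λ (_ , c∈X , c∈Y) → lose c∈X c∈Y) (any? (_∈ᶜ? triangles Y) (triangles X))

Clash : Tile → Tile → Set
Clash X Y = X ≡ Y ⊎ Overlap X Y

clash? : ∀ X Y → Dec (Clash X Y)
clash? X Y = X ≟Tile Y ⊎-dec overlap? X Y

Apart : Tile → Tile → Set
Apart X Y = ¬ Clash X Y

overlap-⊕ : ∀ v {X Y} → Overlap X Y → Overlap (v ⊕ᵗ X) (v ⊕ᵗ Y)
overlap-⊕ v (c , c∈X , c∈Y) = v ⊕ᶜ c , shift c∈X , shift c∈Y
  where
  shift : ∀ {T} → c ∈ triangles T → v ⊕ᶜ c ∈ triangles (v ⊕ᵗ T)
  shift {T} c∈ = subst (v ⊕ᶜ c ∈_) (sym (triangles-⊕ v T)) (∈-map⁺ (v ⊕ᶜ_) c∈)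

clash-⊕ : ∀ v {X Y} → Clash X Y → Clash (v ⊕ᵗ X) (v ⊕ᵗ Y)
clash-⊕ v (inj₁ refl) = inj₁ refl
clash-⊕ v (inj₂ X∩Y)  = inj₂ (overlap-⊕ v X∩Y)

data Triangle : Cell → Set where
  ▲ : ∀ p → Triangle (up p)
  ▼ : ∀ p → Triangle (dn p)

triangles-Triangle : ∀ T {c} → c ∈ triangles T → Triangle c
triangles-Triangle (_ , ab) (here refl)         = ▲ _
triangles-Triangle (_ , ab) (there (here refl)) = ▼ _
triangles-Triangle (_ , bc) (here refl)         = ▼ _
triangles-Triangle (_ , bc) (there (here refl)) = ▲ _
triangles-Triangle (_ , ac) (here refl)         = ▲ _
triangles-Triangle (_ , ac) (there (here refl)) = ▼ _

Triangle-not-vertex : ∀ {c v} → Triangle c → c ≢ vtx v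
Triangle-not-vertex (▲ _) ()
Triangle-not-vertex (▼ _) ()

Triangle-not-in-edge : ∀ {c e} → Triangle c → ¬ InClosedEdge e c
Triangle-not-in-edge (▲ _) (inj₁ ())
Triangle-not-in-edge (▲ _) (inj₂ (inj₁ ()))
Triangle-not-in-edge (▲ _) (inj₂ (inj₂ ()))
Triangle-not-in-edge (▼ _) (inj₁ ())
Triangle-not-in-edge (▼ _) (inj₂ (inj₁ ()))
Triangle-not-in-edge (▼ _) (inj₂ (inj₂ ()))

triangle-meet : ∀ {X Y c} → c ∈ triangles X → c ∈ triangles Y → Meet X Y c
triangle-meet c∈X c∈Y = Any.map inj₁ c∈X , Any.map inj₁ c∈Y

P2⇒apart : ∀ {ts X Y} → P2 ts → X ∈ ts → Y ∈ ts → X ≢ Y → Apart X Y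
P2⇒apart p2 X∈ Y∈ X≢Y (inj₁ X≡Y) = X≢Y X≡Y
P2⇒apart {X = X} p2 X∈ Y∈ X≢Y (inj₂ (c , c∈X , c∈Y)) with p2 X∈ Y∈ X≢Y
... | inj₁ disjoint = disjoint c (triangle-meet c∈X c∈Y)
... | inj₂ (inj₁ (_ , _ , _ , meet⇔)) =
  Triangle-not-vertex (triangles-Triangle X c∈X) (Equivalence.to (meet⇔ c) (triangle-meet c∈X c∈Y))
... | inj₂ (inj₂ (_ , _ , meet⇔)) =
  Triangle-not-in-edge (triangles-Triangle X c∈X) (Equivalence.to (meet⇔ c) (triangle-meet c∈X c∈Y))

-- Local configurations around an edge

∀∈ : {A : Set} → List A → (A → Set) → Set
∀∈ xs P = ∀ {x} → x ∈ xs → P x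

syntax ∀∈ xs (λ x → P) = ∀[ x ∈ xs ] P

∀∈? : {A : Set} {P : A → Set} (xs : List A) → Decidable P → Dec (∀∈ xs P)
∀∈? xs P? = map′ All.lookup All.tabulate (all? P? xs)

syntax ∀∈? xs (λ x → P?) = ∀?[ x ∈ xs ] P?

directions : List Dir
directions = dA ∷ dB ∷ dC ∷ []

∈-directions : ∀ d → d ∈ directions
∈-directions dA = here refl
∈-directions dB = there (here refl)
∈-directions dC = there (there (here refl))

-- Opaque, as otherwise `with` on these facts unfolds the decision procedures again.
opaque
  clash-among-three-around-an-edge :
    ∀[ d ∈ directions ] ∀[ X ∈ tilesAround d ] ∀[ Y ∈ tilesAround d ] ∀[ Z ∈ tilesAround d ]
      (Clash X Y ⊎ Clash X Z ⊎ Clash Y Z)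
  clash-among-three-around-an-edge = from-yes
    (∀?[ d ∈ directions ] ∀?[ X ∈ tilesAround d ] ∀?[ Y ∈ tilesAround d ] ∀?[ Z ∈ tilesAround d ]
      (clash? X Y ⊎-dec clash? X Z ⊎-dec clash? Y Z))

  clash-if-two-edges-shared :
    ∀[ d ∈ directions ] ∀[ X ∈ tilesAround d ] ∀[ Y ∈ tilesAround d ]
    ∀[ g ∈ edges X ] (g ∈ edges Y → g ≡ (origin , d) ⊎ Clash X Y)
  clash-if-two-edges-shared = from-yes
    (∀?[ d ∈ directions ] ∀?[ X ∈ tilesAround d ] ∀?[ Y ∈ tilesAround d ]
     ∀?[ g ∈ edges X ] (g ∈ᵉ? edges Y →-dec (g ≟Edge (origin , d) ⊎-dec clash? X Y)))

  clash-at-ends-of-straight-chain :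
    ∀[ d ∈ directions ] ∀[ X ∈ tilesAround d ] ∀[ Y ∈ tilesAround d ]
    ∀[ e′ ∈ edges Y ] (dirOf e′ ≡ d → ∀[ Z ∈ tilesOn e′ ]
    ∀[ g ∈ edges X ] (g ∈ edges Z →
      Clash X Y ⊎ Clash Y Z ⊎ Clash X Z))
  clash-at-ends-of-straight-chain = from-yes
    (∀?[ d ∈ directions ] ∀?[ X ∈ tilesAround d ] ∀?[ Y ∈ tilesAround d ]
     ∀?[ e′ ∈ edges Y ] (dirOf e′ ≟Dir d →-dec ∀?[ Z ∈ tilesOn e′ ]
     ∀?[ g ∈ edges X ] (g ∈ᵉ? edges Z →-dec
       (clash? X Y ⊎-dec clash? Y Z ⊎-dec clash? X Z))))

  clash-in-crossing-chains :
    ∀[ d ∈ directions ] ∀[ X ∈ tilesAround d ] ∀[ Y ∈ tilesAround d ]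
    ∀[ e′ ∈ edges Y ] (dirOf e′ ≡ d → ∀[ Z ∈ tilesOn e′ ]
    ∀[ f ∈ edges X ] (dirOf f ≢ d → ∀[ W ∈ tilesOn f ]
    ∀[ f′ ∈ edges W ] (dirOf f′ ≡ dirOf f → f′ ∈ edges Z →
      Clash X Y ⊎ Clash Y Z ⊎ Clash X Z ⊎ Clash X W ⊎ Clash W Z)))
  clash-in-crossing-chains = from-yes
    (∀?[ d ∈ directions ] ∀?[ X ∈ tilesAround d ] ∀?[ Y ∈ tilesAround d ]
     ∀?[ e′ ∈ edges Y ] (dirOf e′ ≟Dir d →-dec ∀?[ Z ∈ tilesOn e′ ]
     ∀?[ f ∈ edges X ] (¬? (dirOf f ≟Dir d) →-dec ∀?[ W ∈ tilesOn f ]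
     ∀?[ f′ ∈ edges W ] (dirOf f′ ≟Dir dirOf f →-dec (f′ ∈ᵉ? edges Z →-dec
       (clash? X Y ⊎-dec clash? Y Z ⊎-dec clash? X Z ⊎-dec clash? X W ⊎-dec clash? W Z))))))

no-three-tiles-share-an-edge : ∀ {X Y Z g} → Apart X Y → Apart X Z → Apart Y Z →
  IsEdgeOf g X → IsEdgeOf g Y → IsEdgeOf g Z → ⊥
no-three-tiles-share-an-edge {X} {Y} {Z} {q , d} X#Y X#Z Y#Z gX gY gZ
  with tile-on-edge₀ {T = X} gX | tile-on-edge₀ {T = Y} gY | tile-on-edge₀ {T = Z} gZ
... | X₀ , X₀∈ , refl | Y₀ , Y₀∈ , refl | Z₀ , Z₀∈ , refl
  with clash-among-three-around-an-edge (∈-directions d) X₀∈ Y₀∈ Z₀∈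
... | inj₁ clash        = X#Y (clash-⊕ q clash)
... | inj₂ (inj₁ clash) = X#Z (clash-⊕ q clash)
... | inj₂ (inj₂ clash) = Y#Z (clash-⊕ q clash)

apart-tiles-share-at-most-one-edge : ∀ {X Y g g′} → Apart X Y →
  ShareEdge X Y g → ShareEdge X Y g′ → g′ ≡ g
apart-tiles-share-at-most-one-edge {X} {Y} {q , d} X#Y (gX , gY) (g′X , g′Y)
  with tile-on-edge₀ {T = X} gX | tile-on-edge₀ {T = Y} gY
... | X₀ , X₀∈ , refl | Y₀ , Y₀∈ , refl with edge-of-⊕ {v = q} {T = X₀} g′X
... | g₀ , g₀∈X₀ , refl
  with clash-if-two-edges-shared (∈-directions d) X₀∈ Y₀∈ g₀∈X₀
         (⊕-edge-of-⊕ {v = q} {T = Y₀} g′Y)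
... | inj₁ refl  = cong (_, d) (⊕-identityʳ q)
... | inj₂ clash = ⊥-elim (X#Y (clash-⊕ q clash))

straight-chain-ends-share-no-edge : ∀ {X Y Z e e′ g} → Apart X Y → Apart Y Z → Apart X Z →
  ShareEdge X Y e → ShareEdge Y Z e′ → dirOf e ≡ dirOf e′ → ¬ ShareEdge X Z g
straight-chain-ends-share-no-edge {X} {Y} {Z} {q , d} X#Y Y#Z X#Z (eX , eY) (e′Y , e′Z) d≡d′ (gX , gZ)
  with tile-on-edge₀ {T = X} eX | tile-on-edge₀ {T = Y} eY
... | X₀ , X₀∈ , refl | Y₀ , Y₀∈ , refl
  with edge-of-⊕ {v = q} {T = Y₀} e′Y | edge-of-⊕ {v = q} {T = X₀} gX
... | e′₀ , e′₀∈Y₀ , refl | g₀ , g₀∈X₀ , refl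
  with tile-on-edge {v = q} {e = e′₀} {T = Z} e′Z
... | Z₀ , Z₀∈ , refl
  with clash-at-ends-of-straight-chain (∈-directions d) X₀∈ Y₀∈ e′₀∈Y₀ (sym d≡d′) Z₀∈ g₀∈X₀
         (⊕-edge-of-⊕ {v = q} {T = Z₀} gZ)
... | inj₁ clash        = X#Y (clash-⊕ q clash)
... | inj₂ (inj₁ clash) = Y#Z (clash-⊕ q clash)
... | inj₂ (inj₂ clash) = X#Z (clash-⊕ q clash)

crossing-straight-chains : ∀ {X Y Z W e e′ f f′} →
  Apart X Y → Apart Y Z → Apart X Z → Apart X W → Apart W Z →
  ShareEdge X Y e → ShareEdge Y Z e′ → dirOf e ≡ dirOf e′ →
  ShareEdge X W f → ShareEdge W Z f′ → dirOf f ≡ dirOf f′ → dirOf f ≢ dirOf e → ⊥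
crossing-straight-chains {X} {Y} {Z} {W} {q , d} X#Y Y#Z X#Z X#W W#Z
  (eX , eY) (e′Y , e′Z) d≡d′ (fX , fW) (f′W , f′Z) dir-f≡dir-f′ dir-f≢d
  with tile-on-edge₀ {T = X} eX | tile-on-edge₀ {T = Y} eY
... | X₀ , X₀∈ , refl | Y₀ , Y₀∈ , refl
  with edge-of-⊕ {v = q} {T = Y₀} e′Y | edge-of-⊕ {v = q} {T = X₀} fX
... | e′₀ , e′₀∈Y₀ , refl | f₀ , f₀∈X₀ , refl
  with tile-on-edge {v = q} {e = e′₀} {T = Z} e′Z | tile-on-edge {v = q} {e = f₀} {T = W} fW
... | Z₀ , Z₀∈ , refl | W₀ , W₀∈ , refl with edge-of-⊕ {v = q} {T = W₀} f′W
... | f′₀ , f′₀∈W₀ , refl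
  with clash-in-crossing-chains (∈-directions d) X₀∈ Y₀∈ e′₀∈Y₀ (sym d≡d′) Z₀∈ f₀∈X₀ dir-f≢d
         W₀∈ f′₀∈W₀ (sym dir-f≡dir-f′) (⊕-edge-of-⊕ {v = q} {T = Z₀} f′Z)
... | inj₁ clash                      = X#Y (clash-⊕ q clash)
... | inj₂ (inj₁ clash)               = Y#Z (clash-⊕ q clash)
... | inj₂ (inj₂ (inj₁ clash))        = X#Z (clash-⊕ q clash)
... | inj₂ (inj₂ (inj₂ (inj₁ clash))) = X#W (clash-⊕ q clash)
... | inj₂ (inj₂ (inj₂ (inj₂ clash))) = W#Z (clash-⊕ q clash)

rhombusSides : Pt → Dir × Dir → List (Edge × Edge)
rhombusSides p (u , w) = ((p , u) , (p ⊕ vec w , u)) ∷ ((p , w) , (p ⊕ vec u , w)) ∷ []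

sides-rhombus : ∀ p o → sides (p , o) ≡ rhombusSides p (spans o)
sides-rhombus p ab = refl
sides-rhombus p bc = refl
sides-rhombus p ac = refl

spans-distinct : ∀ o → proj₁ (spans o) ≢ proj₂ (spans o)
spans-distinct ab ()
spans-distinct bc ()
spans-distinct ac ()

module _ (T : Tile) where

  private
    u w : Dir
    u = proj₁ (spans (proj₂ T))
    w = proj₂ (spans (proj₂ T))

    rhombus : ∀ {s} → s ∈ sides T → s ∈ rhombusSides (proj₁ T) (u , w)
    rhombus {s} = subst (s ∈_) (sides-rhombus (proj₁ T) (proj₂ T))

  side-parallel : ∀ {s} → s ∈ sides T → dirOf (proj₁ s) ≡ dirOf (proj₂ s)
  side-parallel s∈ with rhombus s∈
  ... | here refl         = refl
  ... | there (here refl) = refl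

  side-direction : ∀ {s} → s ∈ sides T → dirOf (proj₁ s) ≡ u ⊎ dirOf (proj₁ s) ≡ w
  side-direction s∈ with rhombus s∈
  ... | here refl         = inj₁ refl
  ... | there (here refl) = inj₂ refl

  sides-nonparallel : ∀ {s s′} → s ∈ sides T → s′ ∈ sides T →
                      dirOf (proj₁ s) ≡ dirOf (proj₁ s′) → s ≡ s′
  sides-nonparallel s∈ s′∈ dir≡ with rhombus s∈ | rhombus s′∈
  ... | here refl         | here refl         = refl
  ... | here refl         | there (here refl) = ⊥-elim (spans-distinct (proj₂ T) dir≡)
  ... | there (here refl) | here refl         = ⊥-elim (spans-distinct (proj₂ T) (sym dir≡))
  ... | there (here refl) | there (here refl) = refl

  edge-direction : ∀ {g s} → s ∈ sides T → g ≡ proj₁ s ⊎ g ≡ proj₂ s →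
                   dirOf g ≡ dirOf (proj₁ s)
  edge-direction s∈ (inj₁ refl) = refl
  edge-direction s∈ (inj₂ refl) = sym (side-parallel s∈)

  edge-direction-spans : ∀ {g} → IsEdgeOf g T → dirOf g ≡ u ⊎ dirOf g ≡ w
  edge-direction-spans g∈T with find g∈T
  ... | s , s∈ , g∈s rewrite edge-direction s∈ g∈s = side-direction s∈

  parallel-edges-opposite : ∀ {g g′} → IsEdgeOf g T → IsEdgeOf g′ T →
                            dirOf g ≡ dirOf g′ → g ≢ g′ → Opposite T g g′
  parallel-edges-opposite g∈T g′∈T dir≡ g≢g′ with find g∈T | find g′∈T
  ... | s , s∈ , g∈s | s′ , s′∈ , g′∈s′
    with sides-nonparallel s∈ s′∈
           (trans (sym (edge-direction s∈ g∈s)) (trans dir≡ (edge-direction s′∈ g′∈s′)))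
  ... | refl with g∈s | g′∈s′
  ...   | inj₁ refl | inj₁ refl = ⊥-elim (g≢g′ refl)
  ...   | inj₁ refl | inj₂ refl = inj₁ s∈
  ...   | inj₂ refl | inj₁ refl = inj₂ s∈
  ...   | inj₂ refl | inj₂ refl = ⊥-elim (g≢g′ refl)

  parallel-edge-in-opposite-pair : ∀ {g e e′} → IsEdgeOf g T → Opposite T e e′ →
                                   dirOf g ≡ dirOf e → g ≡ e ⊎ g ≡ e′
  parallel-edge-in-opposite-pair g∈T (inj₁ ee′∈) dir≡ with find g∈T
  ... | s , s∈ , g∈s with sides-nonparallel s∈ ee′∈ (trans (sym (edge-direction s∈ g∈s)) dir≡)
  ... | refl = g∈s
  parallel-edge-in-opposite-pair g∈T (inj₂ e′e∈) dir≡ with find g∈T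
  ... | s , s∈ , g∈s
    with sides-nonparallel s∈ e′e∈
           (trans (sym (edge-direction s∈ g∈s)) (trans dir≡ (sym (side-parallel e′e∈))))
  ... | refl = Sum.swap g∈s

-- Runs of three tiles

AdjacentAlong : Dir → Tile → Tile → Set
AdjacentAlong d u v = u ≢ v × ∃ λ g → ShareEdge u v g × dirOf g ≡ d

AdjacentAlong-sym : ∀ {d u v} → AdjacentAlong d u v → AdjacentAlong d v u
AdjacentAlong-sym (u≢v , g , uv , dir-g) = ≢-sym u≢v , g , swap uv , dir-g

Ends : Tile → Tile → Tile → Tile → Set
Ends X Z x y = (x ≡ X × y ≡ Z) ⊎ (x ≡ Z × y ≡ X)

Ends-common : ∀ {X Z X′ Z′ x y : Tile} → Ends X Z x y → Ends X′ Z′ x y → Ends X Z X′ Z′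
Ends-common (inj₁ (refl , refl)) (inj₁ (refl , refl)) = inj₁ (refl , refl)
Ends-common (inj₁ (refl , refl)) (inj₂ (refl , refl)) = inj₂ (refl , refl)
Ends-common (inj₂ (refl , refl)) (inj₁ (refl , refl)) = inj₂ (refl , refl)
Ends-common (inj₂ (refl , refl)) (inj₂ (refl , refl)) = inj₁ (refl , refl)

record Run₃ (ts : List Tile) (d : Dir) (X Y Z : Tile) : Set where
  field
    X∈ : X ∈ ts
    Y∈ : Y ∈ ts
    Z∈ : Z ∈ ts
    X≢Y : X ≢ Y
    X≢Z : X ≢ Z
    Y≢Z : Y ≢ Z
    {e e′} : Edge
    XY : ShareEdge X Y e
    YZ : ShareEdge Y Z e′
    dir-e : dirOf e ≡ d
    dir-e′ : dirOf e′ ≡ d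
    opposite : Opposite Y e e′
    maximal : ∀ as bs → PreRun ts (as ++ (X ∷ Y ∷ Z ∷ []) ++ bs) → as ≡ [] × bs ≡ []

  tiles : List Tile
  tiles = X ∷ Y ∷ Z ∷ []

  tiles⊆ : ∀ {t} → t ∈ tiles → t ∈ ts
  tiles⊆ (here refl)                 = X∈
  tiles⊆ (there (here refl))         = Y∈
  tiles⊆ (there (there (here refl))) = Z∈

  adjacent₁₂ : AdjacentAlong d X Y
  adjacent₁₂ = X≢Y , e , XY , dir-e

  adjacent₂₃ : AdjacentAlong d Y Z
  adjacent₂₃ = Y≢Z , e′ , YZ , dir-e′

  adjacent₂₁ : AdjacentAlong d Y X
  adjacent₂₁ = AdjacentAlong-sym adjacent₁₂

  adjacent₃₂ : AdjacentAlong d Z Y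
  adjacent₃₂ = AdjacentAlong-sym adjacent₂₃

  adjacent-or-ends : ∀ {x y} → x ∈ tiles → y ∈ tiles → x ≢ y →
                     AdjacentAlong d x y ⊎ Ends X Z x y
  adjacent-or-ends (here refl)                 (here refl)                 x≢y = ⊥-elim (x≢y refl)
  adjacent-or-ends (here refl)                 (there (here refl))         _   = inj₁ adjacent₁₂
  adjacent-or-ends (here refl)                 (there (there (here refl))) _   = inj₂ (inj₁ (refl , refl))
  adjacent-or-ends (there (here refl))         (here refl)                 _   = inj₁ adjacent₂₁
  adjacent-or-ends (there (here refl))         (there (here refl))         x≢y = ⊥-elim (x≢y refl)
  adjacent-or-ends (there (here refl))         (there (there (here refl))) _   = inj₁ adjacent₂₃
  adjacent-or-ends (there (there (here refl))) (here refl)                 _   = inj₂ (inj₂ (refl , refl))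
  adjacent-or-ends (there (there (here refl))) (there (here refl))         _   = inj₁ adjacent₃₂
  adjacent-or-ends (there (there (here refl))) (there (there (here refl))) x≢y = ⊥-elim (x≢y refl)

  edge-along : ∀ {t} → t ∈ tiles → ∃ λ g → IsEdgeOf g t × dirOf g ≡ d
  edge-along (here refl)                 = e , proj₁ XY , dir-e
  edge-along (there (here refl))         = e , proj₂ XY , dir-e
  edge-along (there (there (here refl))) = e′ , proj₂ YZ , dir-e′

  direction-spans : ∀ {t} → t ∈ tiles →
                    d ≡ proj₁ (spans (proj₂ t)) ⊎ d ≡ proj₂ (spans (proj₂ t))
  direction-spans {t} t∈ with edge-along t∈
  ... | g , g∈t , refl = edge-direction-spans t g∈t

  no-tile-before : ∀ {v} → ¬ PreRun ts (v ∷ tiles)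
  no-tile-before pre with maximal (_ ∷ []) [] pre
  ... | () , _

  no-tile-after : ∀ {v} → ¬ PreRun ts (tiles ++ v ∷ [])
  no-tile-after pre with maximal [] (_ ∷ []) pre
  ... | _ , ()

length≡3 : ∀ {A : Set} (xs : List A) → length xs ≡ 3 → ∃ λ x → ∃₂ λ y z → xs ≡ x ∷ y ∷ z ∷ []
length≡3 (x ∷ y ∷ z ∷ []) refl = x , y , z , refl

IsRun⇒Run₃ : ∀ {ts xs} → P45 ts → IsRun ts xs →
             ∃ λ d → ∃ λ X → ∃₂ λ Y Z → xs ≡ X ∷ Y ∷ Z ∷ [] × Run₃ ts d X Y Z
IsRun⇒Run₃ {xs = xs} p45 run with length≡3 xs (p45 xs run)
IsRun⇒Run₃ p45 ((X∈ ∷ Y∈ ∷ Z∈ ∷ [] , (X≢Y ∷ X≢Z ∷ []) ∷ (Y≢Z ∷ []) ∷ [] ∷ [] ,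
                 d , _ , cons XY dir-e opposite (two YZ dir-e′)) , maximal)
  | X , Y , Z , refl =
  d , X , Y , Z , refl ,
  record { X∈ = X∈ ; Y∈ = Y∈ ; Z∈ = Z∈ ; X≢Y = X≢Y ; X≢Z = X≢Z ; Y≢Z = Y≢Z
         ; XY = XY ; YZ = YZ ; dir-e = dir-e ; dir-e′ = dir-e′ ; opposite = opposite
         ; maximal = maximal }

module Run₃-neighbours {ts d X Y Z} (p2 : P2 ts) (r : Run₃ ts d X Y Z) where
  open Run₃ r

  private
    apart : ∀ {u v} → u ∈ ts → v ∈ ts → u ≢ v → Apart u v
    apart = P2⇒apart p2
    X#Y : Apart X Y
    X#Y = apart X∈ Y∈ X≢Y
    X#Z : Apart X Z
    X#Z = apart X∈ Z∈ X≢Z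
    Y#Z : Apart Y Z
    Y#Z = apart Y∈ Z∈ Y≢Z

  ends-share-no-edge : ∀ {x y g} → Ends X Z x y → ¬ ShareEdge x y g
  ends-share-no-edge (inj₁ (refl , refl)) =
    straight-chain-ends-share-no-edge X#Y Y#Z X#Z XY YZ (trans dir-e (sym dir-e′))
  ends-share-no-edge (inj₂ (refl , refl)) xy = ends-share-no-edge (inj₁ (refl , refl)) (swap xy)

  first-neighbour : ∀ {v} → v ∈ ts → AdjacentAlong d X v → v ≡ Y
  first-neighbour {v} v∈ (X≢v , g , Xv , dir-g) with v ≟Tile Y | g ≟Edge e
  ... | yes v≡Y | _        = v≡Y
  ... | no v≢Y  | yes refl =
    ⊥-elim (no-three-tiles-share-an-edge X#Y (apart X∈ v∈ X≢v) (apart Y∈ v∈ (≢-sym v≢Y))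
                                         (proj₁ XY) (proj₂ XY) (proj₂ Xv))
  ... | no v≢Y  | no g≢e   = ⊥-elim (no-tile-before prepended)
    where
    v≢Z : v ≢ Z
    v≢Z refl = ends-share-no-edge (inj₁ (refl , refl)) Xv
    prepended : PreRun ts (v ∷ tiles)
    prepended =
      (v∈ ∷ X∈ ∷ Y∈ ∷ Z∈ ∷ []) ,
      ((≢-sym X≢v ∷ v≢Y ∷ v≢Z ∷ []) ∷ (X≢Y ∷ X≢Z ∷ []) ∷ (Y≢Z ∷ []) ∷ [] ∷ []) ,
      d , g , cons (swap Xv) dir-g
                (parallel-edges-opposite X (proj₁ Xv) (proj₁ XY) (trans dir-g (sym dir-e)) g≢e)
                (cons XY dir-e opposite (two YZ dir-e′))

  last-neighbour : ∀ {v} → v ∈ ts → AdjacentAlong d Z v → v ≡ Y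
  last-neighbour {v} v∈ (Z≢v , g , Zv , dir-g) with v ≟Tile Y | e′ ≟Edge g
  ... | yes v≡Y | _        = v≡Y
  ... | no v≢Y  | yes refl =
    ⊥-elim (no-three-tiles-share-an-edge Y#Z (apart Y∈ v∈ (≢-sym v≢Y)) (apart Z∈ v∈ Z≢v)
                                         (proj₁ YZ) (proj₂ YZ) (proj₂ Zv))
  ... | no v≢Y  | no e′≢g  = ⊥-elim (no-tile-after appended)
    where
    v≢X : v ≢ X
    v≢X refl = ends-share-no-edge (inj₂ (refl , refl)) Zv
    appended : PreRun ts (tiles ++ v ∷ [])
    appended =
      (X∈ ∷ Y∈ ∷ Z∈ ∷ v∈ ∷ []) ,
      ((X≢Y ∷ X≢Z ∷ ≢-sym v≢X ∷ []) ∷ (Y≢Z ∷ ≢-sym v≢Y ∷ []) ∷ (Z≢v ∷ []) ∷ [] ∷ []) ,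
      d , e , cons XY dir-e opposite
                (cons YZ dir-e′
                  (parallel-edges-opposite Z (proj₂ YZ) (proj₁ Zv) (trans dir-e′ (sym dir-g)) e′≢g)
                  (two Zv dir-g))

  middle-neighbour : ∀ {v} → v ∈ ts → AdjacentAlong d Y v → v ≡ X ⊎ v ≡ Z
  middle-neighbour {v} v∈ (Y≢v , g , Yv , dir-g) with v ≟Tile X | v ≟Tile Z
  ... | yes v≡X | _       = inj₁ v≡X
  ... | no _    | yes v≡Z = inj₂ v≡Z
  ... | no v≢X  | no v≢Z
    with parallel-edge-in-opposite-pair Y (proj₁ Yv) opposite (trans dir-g (sym dir-e))
  ...   | inj₁ refl =
    ⊥-elim (no-three-tiles-share-an-edge X#Y (apart X∈ v∈ (≢-sym v≢X)) (apart Y∈ v∈ Y≢v)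
                                         (proj₁ XY) (proj₂ XY) (proj₂ Yv))
  ...   | inj₂ refl =
    ⊥-elim (no-three-tiles-share-an-edge Y#Z (apart Y∈ v∈ Y≢v) (apart Z∈ v∈ (≢-sym v≢Z))
                                         (proj₁ YZ) (proj₂ YZ) (proj₂ Yv))

  neighbour-in-run : ∀ {u v} → u ∈ tiles → v ∈ ts → AdjacentAlong d u v → v ∈ tiles
  neighbour-in-run (here refl) v∈ adj = there (here (first-neighbour v∈ adj))
  neighbour-in-run (there (here refl)) v∈ adj with middle-neighbour v∈ adj
  ... | inj₁ v≡X = here v≡X
  ... | inj₂ v≡Z = there (there (here v≡Z))
  neighbour-in-run (there (there (here refl))) v∈ adj = there (here (last-neighbour v∈ adj))

runs-along-same-direction-coincide : ∀ {ts d X Y Z X′ Y′ Z′ t} → P2 ts →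
  Run₃ ts d X Y Z → Run₃ ts d X′ Y′ Z′ →
  t ∈ X ∷ Y ∷ Z ∷ [] → t ∈ X′ ∷ Y′ ∷ Z′ ∷ [] →
  SameRun (X′ ∷ Y′ ∷ Z′ ∷ []) (X ∷ Y ∷ Z ∷ [])
runs-along-same-direction-coincide {Y′ = Y′} p2 r r′ t∈r t∈r′ = coincide (middle∈r t∈r′)
  where
  open Run₃-neighbours p2 r
  module R′ = Run₃ r′

  middle∈r : _ ∈ R′.tiles → Y′ ∈ Run₃.tiles r
  middle∈r (here refl)                 = neighbour-in-run t∈r R′.Y∈ R′.adjacent₁₂
  middle∈r (there (here refl))         = t∈r
  middle∈r (there (there (here refl))) = neighbour-in-run t∈r R′.Y∈ R′.adjacent₃₂

  coincide : Y′ ∈ Run₃.tiles r → SameRun R′.tiles (Run₃.tiles r)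
  coincide (here refl) =
    ⊥-elim (R′.X≢Z (trans (first-neighbour R′.X∈ R′.adjacent₂₁)
                          (sym (first-neighbour R′.Z∈ R′.adjacent₂₃))))
  coincide (there (there (here refl))) =
    ⊥-elim (R′.X≢Z (trans (last-neighbour R′.X∈ R′.adjacent₂₁)
                          (sym (last-neighbour R′.Z∈ R′.adjacent₂₃))))
  coincide (there (here refl))
    with middle-neighbour R′.X∈ R′.adjacent₂₁
       | middle-neighbour R′.Z∈ R′.adjacent₂₃
  ... | inj₁ refl | inj₁ refl = ⊥-elim (R′.X≢Z refl)
  ... | inj₁ refl | inj₂ refl = inj₁ refl
  ... | inj₂ refl | inj₁ refl = inj₂ refl
  ... | inj₂ refl | inj₂ refl = ⊥-elim (R′.X≢Z refl)

module _ {ts d d′ X Y Z X′ Y′ Z′} (p2 : P2 ts) (r : Run₃ ts d X Y Z) (r′ : Run₃ ts d′ X′ Y′ Z′)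
         (d≢d′ : d ≢ d′) where
  private
    module R  = Run₃ r
    module R′ = Run₃ r′
    apart : ∀ {u v} → u ∈ ts → v ∈ ts → u ≢ v → Apart u v
    apart = P2⇒apart p2
    d′≢d : ∀ {a b} → a ≡ d′ → b ≡ d → a ≢ b
    d′≢d refl refl d′≡d = d≢d′ (sym d′≡d)

  crossing-runs-have-different-ends : ¬ Ends X Z X′ Z′
  crossing-runs-have-different-ends (inj₁ (refl , refl)) =
    crossing-straight-chains
      (apart R.X∈ R.Y∈ R.X≢Y) (apart R.Y∈ R.Z∈ R.Y≢Z) (apart R.X∈ R.Z∈ R.X≢Z)
      (apart R′.X∈ R′.Y∈ R′.X≢Y) (apart R′.Y∈ R′.Z∈ R′.Y≢Z)
      R.XY R.YZ (trans R.dir-e (sym R.dir-e′))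
      R′.XY R′.YZ (trans R′.dir-e (sym R′.dir-e′)) (d′≢d R′.dir-e R.dir-e)
  crossing-runs-have-different-ends (inj₂ (refl , refl)) =
    crossing-straight-chains
      (apart R.X∈ R.Y∈ R.X≢Y) (apart R.Y∈ R.Z∈ R.Y≢Z) (apart R.X∈ R.Z∈ R.X≢Z)
      (apart R′.Z∈ R′.Y∈ (≢-sym R′.Y≢Z)) (apart R′.Y∈ R′.X∈ (≢-sym R′.X≢Y))
      R.XY R.YZ (trans R.dir-e (sym R.dir-e′))
      (swap R′.YZ) (swap R′.XY) (trans R′.dir-e′ (sym R′.dir-e))
      (d′≢d R′.dir-e′ R.dir-e)

  crossing-runs-share-at-most-one-tile : ∀ {x y} → x ∈ R.tiles → y ∈ R.tiles →
                                         x ∈ R′.tiles → y ∈ R′.tiles → x ≡ y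
  crossing-runs-share-at-most-one-tile {x} {y} x∈r y∈r x∈r′ y∈r′ with x ≟Tile y
  ... | yes x≡y = x≡y
  ... | no x≢y with R.adjacent-or-ends x∈r y∈r x≢y | R′.adjacent-or-ends x∈r′ y∈r′ x≢y
  ...   | inj₁ (_ , g , xy , dir-g) | inj₁ (_ , g′ , xy′ , dir-g′) =
    ⊥-elim (d′≢d dir-g′ dir-g (cong dirOf (apart-tiles-share-at-most-one-edge x#y xy xy′)))
    where
    x#y : Apart x y
    x#y = apart (R.tiles⊆ x∈r) (R.tiles⊆ y∈r) x≢y
  ...   | inj₁ (_ , _ , xy , _) | inj₂ ends′ =
    ⊥-elim (Run₃-neighbours.ends-share-no-edge p2 r′ ends′ xy)
  ...   | inj₂ ends | inj₁ (_ , _ , xy′ , _) =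
    ⊥-elim (Run₃-neighbours.ends-share-no-edge p2 r ends xy′)
  ...   | inj₂ ends | inj₂ ends′ =
    ⊥-elim (crossing-runs-have-different-ends (Ends-common ends ends′))

pigeonhole : ∀ {A : Set} {u w a b c : A} → a ≡ u ⊎ a ≡ w → b ≡ u ⊎ b ≡ w → c ≡ u ⊎ c ≡ w →
             a ≡ b ⊎ a ≡ c ⊎ b ≡ c
pigeonhole (inj₁ refl) (inj₁ refl) _           = inj₁ refl
pigeonhole (inj₂ refl) (inj₂ refl) _           = inj₁ refl
pigeonhole (inj₁ refl) (inj₂ refl) (inj₁ refl) = inj₂ (inj₁ refl)
pigeonhole (inj₁ refl) (inj₂ refl) (inj₂ refl) = inj₂ (inj₂ refl)
pigeonhole (inj₂ refl) (inj₁ refl) (inj₁ refl) = inj₂ (inj₂ refl)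
pigeonhole (inj₂ refl) (inj₁ refl) (inj₂ refl) = inj₂ (inj₁ refl)

module _ {ts} (p2 : P2 ts) (p45 : P45 ts) where

  distinct-runs-share-at-most-one-tile : ∀ {r r′ x y} → IsRun ts r → IsRun ts r′ → ¬ SameRun r r′ →
    x ∈ r → y ∈ r → x ∈ r′ → y ∈ r′ → x ≡ y
  distinct-runs-share-at-most-one-tile run run′ r≉r′ x∈r y∈r x∈r′ y∈r′
    with IsRun⇒Run₃ p45 run | IsRun⇒Run₃ p45 run′
  ... | d , _ , _ , _ , refl , R | d′ , _ , _ , _ , refl , R′ with d ≟Dir d′
  ...   | yes refl = ⊥-elim (r≉r′ (runs-along-same-direction-coincide p2 R′ R x∈r′ x∈r))
  ...   | no d≢d′  = crossing-runs-share-at-most-one-tile p2 R R′ d≢d′ x∈r y∈r x∈r′ y∈r′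

  no-tile-in-three-runs : ∀ {r₁ r₂ r₃ t} → IsRun ts r₁ → IsRun ts r₂ → IsRun ts r₃ →
    ¬ SameRun r₁ r₂ → ¬ SameRun r₁ r₃ → ¬ SameRun r₂ r₃ →
    t ∈ r₁ → t ∈ r₂ → t ∈ r₃ → ⊥
  no-tile-in-three-runs run₁ run₂ run₃ r₁≉r₂ r₁≉r₃ r₂≉r₃ t∈₁ t∈₂ t∈₃
    with IsRun⇒Run₃ p45 run₁ | IsRun⇒Run₃ p45 run₂ | IsRun⇒Run₃ p45 run₃
  ... | _ , _ , _ , _ , refl , R₁ | _ , _ , _ , _ , refl , R₂ | _ , _ , _ , _ , refl , R₃
    with pigeonhole (Run₃.direction-spans R₁ t∈₁) (Run₃.direction-spans R₂ t∈₂)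
                    (Run₃.direction-spans R₃ t∈₃)
  ... | inj₁ refl        = r₁≉r₂ (runs-along-same-direction-coincide p2 R₂ R₁ t∈₂ t∈₁)
  ... | inj₂ (inj₁ refl) = r₁≉r₃ (runs-along-same-direction-coincide p2 R₃ R₁ t∈₃ t∈₁)
  ... | inj₂ (inj₂ refl) = r₂≉r₃ (runs-along-same-direction-coincide p2 R₃ R₂ t∈₃ t∈₂)

-- Existence of runs

∈-++-∷⁻ : ∀ {A : Set} (as : List A) {bs x z} → z ∈ as ++ x ∷ bs → z ≢ x → z ∈ as ++ bs
∈-++-∷⁻ []       (here z≡x) z≢x = ⊥-elim (z≢x z≡x)
∈-++-∷⁻ []       (there z∈) _   = z∈
∈-++-∷⁻ (a ∷ as) (here z≡a) _   = here z≡a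
∈-++-∷⁻ (a ∷ as) (there z∈) z≢x = there (∈-++-∷⁻ as z∈ z≢x)

Unique⇒length≤ : ∀ {A : Set} {xs ys : List A} → Unique xs → All (_∈ ys) xs → length xs ≤ length ys
Unique⇒length≤ {xs = []}     _          _              = z≤n
Unique⇒length≤ {xs = x ∷ xs} (x∉ ∷ !xs) (x∈ys ∷ xs⊆ys) with ∈-∃++ x∈ys
... | as , bs , refl =
  subst (suc (length xs) ≤_) (sym (length-++-sucʳ as x bs))
    (s≤s (Unique⇒length≤ !xs (All.zipWith (λ (x≢z , z∈) → ∈-++-∷⁻ as z∈ (≢-sym x≢z))
                                           (x∉ , xs⊆ys))))

length-++-++ : ∀ {A : Set} (as xs bs : List A) → (as ≡ [] × bs ≡ []) ⊎ length xs < length (as ++ xs ++ bs)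
length-++-++ []       xs []       = inj₁ (refl , refl)
length-++-++ []       xs (b ∷ bs) =
  inj₂ (subst (length xs <_) (sym (length-++-sucʳ xs b bs)) (s≤s (length-++-≤ˡ xs)))
length-++-++ (a ∷ as) xs bs       =
  inj₂ (s≤s (≤-trans (length-++-≤ˡ xs) (length-++-≤ʳ (xs ++ bs) {as})))

another-tile : ∀ t {ts} → Unique ts → 2 ≤ length ts → ∃ λ y → y ∈ ts × t ≢ y
another-tile t {a ∷ b ∷ _} ((a≢b ∷ _) ∷ _) _ with t ≟Tile a
... | yes refl = b , there (here refl) , a≢b
... | no t≢a   = a , here refl , t≢a
another-tile t {_ ∷ []} _ (s≤s ())

module _ {ts : List Tile} where

  PreRun-length≤ : ∀ {xs} → PreRun ts xs → length xs ≤ length ts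
  PreRun-length≤ (xs⊆ts , !xs , _) = Unique⇒length≤ !xs xs⊆ts

  Extendable : List Tile → Set
  Extendable xs = ∃₂ λ as bs → PreRun ts (as ++ xs ++ bs) × length xs < length (as ++ xs ++ bs)

  run-unless-extendable : ∀ {xs} → PreRun ts xs → ¬ Extendable xs → IsRun ts xs
  run-unless-extendable {xs} pre ¬extendable = pre , maximal
    where
    maximal : ∀ as bs → PreRun ts (as ++ xs ++ bs) → as ≡ [] × bs ≡ []
    maximal as bs pre′ with length-++-++ as xs bs
    ... | inj₁ empty  = empty
    ... | inj₂ longer = ⊥-elim (¬extendable (as , bs , pre′ , longer))

  OnRun : Tile → Set
  OnRun t = ∃ λ xs → IsRun ts xs × t ∈ xs

  -- Whether a prerun extends is not decidable, so maximal preruns exist only under ¬ ¬;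
  -- runsThrough-positive removes the ¬ ¬, its conclusion being decidable.
  run-or-extendable : ∀ {xs t} → PreRun ts xs → t ∈ xs → ¬ ¬ (OnRun t ⊎ Extendable xs)
  run-or-extendable {xs} pre t∈ k = ¬¬-excluded-middle λ where
    (yes extendable) → k (inj₂ extendable)
    (no ¬extendable) → k (inj₁ (xs , run-unless-extendable pre ¬extendable , t∈))

  PreRun-extends-to-run : ∀ n {xs t} → length ts ≤ n + length xs → PreRun ts xs → t ∈ xs → ¬ ¬ OnRun t
  PreRun-extends-to-run zero bound pre t∈ ¬onRun = run-or-extendable pre t∈ λ where
    (inj₁ onRun)                   → ¬onRun onRun
    (inj₂ (_ , _ , pre′ , longer)) → <⇒≱ longer (≤-trans (PreRun-length≤ pre′) bound)
  PreRun-extends-to-run (suc n) {xs} bound pre t∈ ¬onRun = run-or-extendable pre t∈ λ where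
    (inj₁ onRun)                     → ¬onRun onRun
    (inj₂ (as , bs , pre′ , longer)) →
      PreRun-extends-to-run n
        (≤-trans bound (≤-trans (≤-reflexive (sym (+-suc n (length xs)))) (+-monoʳ-≤ n longer)))
        pre′ (∈-++⁺ʳ as (∈-++⁺ˡ t∈)) ¬onRun

  tile-lies-on-a-run : ∀ {t} → Unique ts → 2 ≤ length ts → P1 ts → t ∈ ts → ¬ ¬ OnRun t
  tile-lies-on-a-run {t} !ts 2≤ p1 t∈ with another-tile t !ts 2≤
  ... | y , y∈ , t≢y with p1 t∈ y∈
  ...   | ε = ⊥-elim (t≢y refl)
  ...   | (_ , u∈ , t≢u , e , tu) ◅ _ =
    PreRun-extends-to-run (length ts) (m≤m+n (length ts) 2)
      ((t∈ ∷ u∈ ∷ []) , ((t≢u ∷ []) ∷ [] ∷ []) , dirOf e , e , two tu refl) (here refl)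

T-does : ∀ {P : Set} (p? : Dec P) → T (does p?) → P
T-does (yes p) _ = p

SameRun-∈ : ∀ {xs r t} → SameRun xs r → t ∈ xs → t ∈ r
SameRun-∈ (inj₁ refl) t∈ = t∈
SameRun-∈ (inj₂ refl) t∈ = reverse⁻ t∈

runsThrough-positive : ∀ {ts rs t} → Unique ts → 2 ≤ length ts → P1 ts →
  (∀ xs → IsRun ts xs → Any (SameRun xs) rs) → t ∈ ts → 1 ≤ runsThrough t rs
runsThrough-positive {ts} {rs} {t} !ts 2≤ p1 covered t∈ =
  decidable-stable (1 ≤? runsThrough t rs) λ ¬positive →
    tile-lies-on-a-run !ts 2≤ p1 t∈ λ (xs , run , t∈xs) →
      ¬positive (positive (find (covered xs run)) t∈xs)
  where
  positive : ∀ {xs} → (∃ λ r → r ∈ rs × SameRun xs r) → t ∈ xs → 1 ≤ runsThrough t rs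
  positive (r , r∈rs , same) t∈xs =
    ∈-length (∈-filter⁺ (T? ∘ λ r → does (t ∈? r)) r∈rs
                        (Equivalence.from T-≡ (dec-true (t ∈? r) (SameRun-∈ same t∈xs))))

at-most-two : ∀ {A : Set} {R : A → A → Set} {xs} → AllPairs R xs →
  (∀ {a b c} → a ∈ xs → b ∈ xs → c ∈ xs → R a b → R a c → R b c → ⊥) → length xs ≤ 2
at-most-two {xs = []}             _ _ = z≤n
at-most-two {xs = _ ∷ []}         _ _ = s≤s z≤n
at-most-two {xs = _ ∷ _ ∷ []}     _ _ = s≤s (s≤s z≤n)
at-most-two {xs = _ ∷ _ ∷ _ ∷ _} ((Rab ∷ Rac ∷ _) ∷ (Rbc ∷ _) ∷ _) no-three =
  ⊥-elim (no-three (here refl) (there (here refl)) (there (there (here refl))) Rab Rac Rbc)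

runsThrough≤2 : ∀ {ts rs t} → P2 ts → P45 ts → RunEnumeration ts rs → runsThrough t rs ≤ 2
runsThrough≤2 {ts} {rs} {t} p2 p45 (runs , _ , distinct) =
  at-most-two (filter⁺ (T? ∘ through) distinct) λ a∈ b∈ c∈ a≉b a≉c b≉c →
    no-tile-in-three-runs p2 p45 (run a∈) (run b∈) (run c∈) a≉b a≉c b≉c
                          (t∈ a∈) (t∈ b∈) (t∈ c∈)
  where
  through : List Tile → Bool
  through r = does (t ∈? r)
  run : ∀ {r} → r ∈ filterᵇ through rs → IsRun ts r
  run r∈ = All.lookup runs (proj₁ (∈-filter⁻ (T? ∘ through) {xs = rs} r∈))
  t∈ : ∀ {r} → r ∈ filterᵇ through rs → t ∈ r
  t∈ {r} r∈ = T-does (t ∈? r) (proj₂ (∈-filter⁻ (T? ∘ through) {xs = rs} r∈))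

-- Double counting

𝟙 : Bool → ℕ
𝟙 true  = 1
𝟙 false = 0

𝟙-∧ : ∀ a b → 𝟙 (a ∧ b) ≡ 𝟙 a * 𝟙 b
𝟙-∧ true  true  = refl
𝟙-∧ true  false = refl
𝟙-∧ false _     = refl

𝟙-∨-disjoint : ∀ {P Q : Set} (p? : Dec P) (q? : Dec Q) → (P → ¬ Q) →
               𝟙 (does p? ∨ does q?) ≡ 𝟙 (does p?) + 𝟙 (does q?)
𝟙-∨-disjoint (yes p) q? p⇒¬q rewrite dec-false q? (p⇒¬q p) = refl
𝟙-∨-disjoint (no _)  q? _ = refl

∑ : {A : Set} → List A → (A → ℕ) → ℕ
∑ xs f = sum (map f xs)

syntax ∑ xs (λ x → e) = ∑[ x ∈ xs ] e

module _ {A : Set} where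

  ∑-cong : ∀ {f g : A → ℕ} xs → (∀ {x} → x ∈ xs → f x ≡ g x) → ∑ xs f ≡ ∑ xs g
  ∑-cong []       _  = refl
  ∑-cong (x ∷ xs) eq = cong₂ _+_ (eq (here refl)) (∑-cong xs (eq ∘ there))

  ∑-zero : (xs : List A) → ∑[ x ∈ xs ] 0 ≡ 0
  ∑-zero []       = refl
  ∑-zero (_ ∷ xs) = ∑-zero xs

  ∑-1 : (xs : List A) → ∑[ x ∈ xs ] 1 ≡ length xs
  ∑-1 []       = refl
  ∑-1 (_ ∷ xs) = cong suc (∑-1 xs)

  ∑-+ : ∀ (f g : A → ℕ) xs → ∑[ x ∈ xs ] (f x + g x) ≡ ∑ xs f + ∑ xs g
  ∑-+ f g []       = refl
  ∑-+ f g (x ∷ xs) =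
    trans (cong (_+_ (f x + g x)) (∑-+ f g xs)) (+-interchange (f x) (g x) (∑ xs f) (∑ xs g))

  ∑-*ˡ : ∀ c (f : A → ℕ) xs → ∑[ x ∈ xs ] (c * f x) ≡ c * ∑ xs f
  ∑-*ˡ c f []       = sym (*-zeroʳ c)
  ∑-*ˡ c f (x ∷ xs) = begin
    c * f x + ∑[ x ∈ xs ] (c * f x) ≡⟨ cong (_+_ (c * f x)) (∑-*ˡ c f xs) ⟩
    c * f x + c * ∑ xs f            ≡⟨ sym (*-distribˡ-+ c (f x) _) ⟩
    c * (f x + ∑ xs f)              ∎
    where open ≡-Reasoning

  ∑-const : ∀ c (xs : List A) → ∑[ x ∈ xs ] c ≡ c * length xs
  ∑-const c xs = begin
    ∑[ x ∈ xs ] c        ≡⟨ ∑-cong xs (λ _ → sym (*-identityʳ c)) ⟩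
    ∑[ x ∈ xs ] (c * 1)  ≡⟨ ∑-*ˡ c (λ _ → 1) xs ⟩
    c * ∑[ x ∈ xs ] 1    ≡⟨ cong (c *_) (∑-1 xs) ⟩
    c * length xs        ∎
    where open ≡-Reasoning

  ∑-++ : ∀ (f : A → ℕ) xs ys → ∑ (xs ++ ys) f ≡ ∑ xs f + ∑ ys f
  ∑-++ f xs ys = trans (cong sum (map-++ f xs ys)) (sum-++ (map f xs) (map f ys))

  ∑-map : ∀ {B : Set} (f : B → ℕ) (g : A → B) xs → ∑ (map g xs) f ≡ ∑[ x ∈ xs ] f (g x)
  ∑-map f g []       = refl
  ∑-map f g (x ∷ xs) = cong (_+_ (f (g x))) (∑-map f g xs)

  length-filterᵇ : ∀ (p : A → Bool) xs → length (filterᵇ p xs) ≡ ∑[ x ∈ xs ] 𝟙 (p x)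
  length-filterᵇ p []       = refl
  length-filterᵇ p (x ∷ xs) with p x
  ... | true  = cong suc (length-filterᵇ p xs)
  ... | false = length-filterᵇ p xs

∑-swap : ∀ {A B : Set} (f : A → B → ℕ) xs ys →
         ∑[ x ∈ xs ] ∑[ y ∈ ys ] f x y ≡ ∑[ y ∈ ys ] ∑[ x ∈ xs ] f x y
∑-swap f []       ys = sym (∑-zero ys)
∑-swap f (x ∷ xs) ys = begin
  ∑ ys (f x) + ∑[ x ∈ xs ] ∑[ y ∈ ys ] f x y
    ≡⟨ cong (_+_ (∑ ys (f x))) (∑-swap f xs ys) ⟩
  ∑ ys (f x) + ∑[ y ∈ ys ] ∑[ x ∈ xs ] f x y
    ≡⟨ sym (∑-+ (f x) (λ y → ∑[ x ∈ xs ] f x y) ys) ⟩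
  ∑[ y ∈ ys ] (f x y + ∑[ x ∈ xs ] f x y)
    ∎
  where open ≡-Reasoning

suc-C2 : ∀ n → suc n C 2 ≡ n + n C 2
suc-C2 n = begin
  suc n C 2      ≡⟨ sym (nCk+nC[k+1]≡[n+1]C[k+1] n 1) ⟩
  n C 1 + n C 2  ≡⟨ cong (_+ n C 2) (nC1≡n n) ⟩
  n + n C 2      ∎
  where open ≡-Reasoning

∑-pairs : ∀ {A : Set} (p : A → Bool) xs →
          ∑[ xy ∈ pairs xs ] 𝟙 (p (proj₁ xy) ∧ p (proj₂ xy)) ≡ (∑[ x ∈ xs ] 𝟙 (p x)) C 2
∑-pairs p []       = refl
∑-pairs p (x ∷ xs) = begin
  ∑ (map (x ,_) xs ++ pairs xs) both
    ≡⟨ ∑-++ both (map (x ,_) xs) (pairs xs) ⟩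
  ∑ (map (x ,_) xs) both + ∑ (pairs xs) both
    ≡⟨ cong₂ _+_ (∑-map both (x ,_) xs) (∑-pairs p xs) ⟩
  ∑[ y ∈ xs ] 𝟙 (p x ∧ p y) + S C 2
    ≡⟨ cong (_+ S C 2) (∑-cong xs (λ {y} _ → 𝟙-∧ (p x) (p y))) ⟩
  ∑[ y ∈ xs ] (𝟙 (p x) * 𝟙 (p y)) + S C 2
    ≡⟨ cong (_+ S C 2) (∑-*ˡ (𝟙 (p x)) (λ y → 𝟙 (p y)) xs) ⟩
  𝟙 (p x) * S + S C 2
    ≡⟨ add-head (p x) ⟩
  (𝟙 (p x) + S) C 2
    ∎
  where
  open ≡-Reasoning
  both : _ × _ → ℕ
  both (y , z) = 𝟙 (p y ∧ p z)
  S = ∑[ y ∈ xs ] 𝟙 (p y)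
  add-head : ∀ b → 𝟙 b * S + S C 2 ≡ (𝟙 b + S) C 2
  add-head true  = trans (cong (_+ S C 2) (+-identityʳ S)) (sym (suc-C2 S))
  add-head false = refl

∈-pairs : ∀ {A : Set} {R : A → A → Set} {xs x y} → AllPairs R xs → (x , y) ∈ pairs xs →
          x ∈ xs × y ∈ xs × R x y
∈-pairs {xs = x ∷ xs} (Rx ∷ Rxs) xy∈ with ∈-++⁻ (map (x ,_) xs) xy∈
... | inj₁ xy∈map with ∈-map⁻ (x ,_) xy∈map
...   | y , y∈ , refl = here refl , there y∈ , All.lookup Rx y∈
∈-pairs {xs = x ∷ xs} (Rx ∷ Rxs) xy∈ | inj₂ xy∈pairs with ∈-pairs Rxs xy∈pairs
...   | x∈ , y∈ , Rxy = there x∈ , there y∈ , Rxy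

module _ {A : Set} {P : A → Set} (P? : Decidable P) where

  ∑-indicator-none : ∀ xs → (∀ {x} → x ∈ xs → ¬ P x) → ∑[ x ∈ xs ] 𝟙 (does (P? x)) ≡ 0
  ∑-indicator-none []       _  = refl
  ∑-indicator-none (x ∷ xs) ¬P rewrite dec-false (P? x) (¬P (here refl)) = ∑-indicator-none xs (¬P ∘ there)

  ∑-indicator-at-most-one : ∀ {xs} → Unique xs →
    (∀ {x y} → x ∈ xs → y ∈ xs → P x → P y → x ≡ y) →
    ∑[ x ∈ xs ] 𝟙 (does (P? x)) ≡ 𝟙 (does (any? P? xs))
  ∑-indicator-at-most-one {[]}     _          _      = refl
  ∑-indicator-at-most-one {x ∷ xs} (x∉ ∷ !xs) unique with P? x
  ... | yes Px =
    cong suc (∑-indicator-none xs λ y∈ Py → All.lookup x∉ y∈ (unique (here refl) (there y∈) Px Py))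
  ... | no _   = ∑-indicator-at-most-one !xs (λ x∈ y∈ → unique (there x∈) (there y∈))

module _ {A : Set} (_≟_ : DecidableEquality A) where
  open DecMembership _≟_ using () renaming (_∈?_ to _∈ᴬ?_)

  ∑-membership : ∀ {xs ys} → Unique xs → Unique ys → All (_∈ xs) ys →
                 ∑[ x ∈ xs ] 𝟙 (does (x ∈ᴬ? ys)) ≡ length ys
  ∑-membership {xs} {[]}     _   _          _              = ∑-zero xs
  ∑-membership {xs} {y ∷ ys} !xs (y∉ ∷ !ys) (y∈xs ∷ ys⊆xs) = begin
    ∑[ x ∈ xs ] 𝟙 (does (x ∈ᴬ? y ∷ ys))
      ≡⟨ ∑-cong xs (λ {x} _ → 𝟙-∨-disjoint (x ≟ y) (x ∈ᴬ? ys)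
                                λ { refl y∈ys → All.lookup y∉ y∈ys refl }) ⟩
    ∑[ x ∈ xs ] (𝟙 (does (x ≟ y)) + 𝟙 (does (x ∈ᴬ? ys)))
      ≡⟨ ∑-+ _ _ xs ⟩
    ∑[ x ∈ xs ] 𝟙 (does (x ≟ y)) + ∑[ x ∈ xs ] 𝟙 (does (x ∈ᴬ? ys))
      ≡⟨ cong₂ _+_ y-once (∑-membership !xs !ys ys⊆xs) ⟩
    1 + length ys
      ∎
    where
    open ≡-Reasoning
    y-once : ∑[ x ∈ xs ] 𝟙 (does (x ≟ y)) ≡ 1
    y-once = begin
      ∑[ x ∈ xs ] 𝟙 (does (x ≟ y))
        ≡⟨ ∑-indicator-at-most-one (_≟ y) !xs (λ { _ _ refl refl → refl }) ⟩
      𝟙 (does (any? (_≟ y) xs))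
        ≡⟨ cong 𝟙 (dec-true (any? (_≟ y) xs) (Any.map sym y∈xs)) ⟩
      1
        ∎

∑-runsThrough : ∀ {ts rs} → Unique ts → P45 ts → All (IsRun ts) rs →
                ∑[ t ∈ ts ] runsThrough t rs ≡ 3 * length rs
∑-runsThrough {ts} {rs} !ts p45 runs = begin
  ∑[ t ∈ ts ] runsThrough t rs
    ≡⟨ ∑-cong ts (λ {t} _ → length-filterᵇ (λ r → does (t ∈? r)) rs) ⟩
  ∑[ t ∈ ts ] ∑[ r ∈ rs ] 𝟙 (does (t ∈? r))
    ≡⟨ ∑-swap (λ t r → 𝟙 (does (t ∈? r))) ts rs ⟩
  ∑[ r ∈ rs ] ∑[ t ∈ ts ] 𝟙 (does (t ∈? r))
    ≡⟨ ∑-cong rs tiles-on-run ⟩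
  ∑[ r ∈ rs ] 3
    ≡⟨ ∑-const 3 rs ⟩
  3 * length rs
    ∎
  where
  open ≡-Reasoning
  tiles-on-run : ∀ {r} → r ∈ rs → ∑[ t ∈ ts ] 𝟙 (does (t ∈? r)) ≡ 3
  tiles-on-run {r} r∈ with All.lookup runs r∈
  ... | run@((r⊆ts , !r , _) , _) = trans (∑-membership _≟Tile_ !ts !r r⊆ts) (p45 r run)

∑-runsThrough-C2 : ∀ {ts rs} → Unique ts → P2 ts → P45 ts → RunEnumeration ts rs →
                   ∑[ t ∈ ts ] (runsThrough t rs C 2) ≡ runGraphEdges rs
∑-runsThrough-C2 {ts} {rs} !ts p2 p45 (runs , _ , distinct) = begin
  ∑[ t ∈ ts ] (runsThrough t rs C 2)
    ≡⟨ ∑-cong ts (λ {t} _ → trans (cong (_C 2) (length-filterᵇ (through t) rs))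
                                  (sym (∑-pairs (through t) rs))) ⟩
  ∑[ t ∈ ts ] ∑[ rr′ ∈ pairs rs ] both t rr′
    ≡⟨ ∑-swap both ts (pairs rs) ⟩
  ∑[ rr′ ∈ pairs rs ] ∑[ t ∈ ts ] both t rr′
    ≡⟨ ∑-cong (pairs rs) common-tiles ⟩
  ∑[ rr′ ∈ pairs rs ] 𝟙 (shareTile (proj₁ rr′) (proj₂ rr′))
    ≡⟨ sym (length-filterᵇ (λ rr′ → shareTile (proj₁ rr′) (proj₂ rr′)) (pairs rs)) ⟩
  runGraphEdges rs
    ∎
  where
  open ≡-Reasoning
  through : Tile → List Tile → Bool
  through t r = does (t ∈? r)
  both : Tile → List Tile × List Tile → ℕ
  both t (r , r′) = 𝟙 (through t r ∧ through t r′)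
  common-tiles : ∀ {rr′} → rr′ ∈ pairs rs →
                 ∑[ t ∈ ts ] both t rr′ ≡ 𝟙 (shareTile (proj₁ rr′) (proj₂ rr′))
  common-tiles {r , r′} rr′∈ with ∈-pairs distinct rr′∈
  ... | r∈ , r′∈ , r≉r′ = begin
    ∑[ t ∈ ts ] both t (r , r′)
      ≡⟨ ∑-indicator-at-most-one (λ t → t ∈? r ×-dec t ∈? r′) !ts
           (λ _ _ (x∈r , x∈r′) (y∈r , y∈r′) →
              distinct-runs-share-at-most-one-tile p2 p45 run run′ r≉r′ x∈r y∈r x∈r′ y∈r′) ⟩
    𝟙 (does (any? (λ t → t ∈? r ×-dec t ∈? r′) ts))
      ≡⟨ cong 𝟙 (does-⇔ (mk⇔ to from) (any? _ ts) (any? (_∈? r′) r)) ⟩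
    𝟙 (shareTile r r′)
      ∎
    where
    run run′ : IsRun ts _
    run  = All.lookup runs r∈
    run′ = All.lookup runs r′∈
    to : Any (λ t → t ∈ r × t ∈ r′) ts → Any (_∈ r′) r
    to common with find common
    ... | _ , _ , t∈r , t∈r′ = lose t∈r t∈r′
    from : Any (_∈ r′) r → Any (λ t → t ∈ r × t ∈ r′) ts
    from common with find common
    ... | _ , t∈r , t∈r′ = lose (All.lookup (proj₁ (proj₁ run)) t∈r) (t∈r , t∈r′)

1+C2 : ∀ {n} → n ≡ 1 ⊎ n ≡ 2 → 1 + n C 2 ≡ n
1+C2 (inj₁ refl) = refl
1+C2 (inj₂ refl) = refl

𝟙[≡1]+2C2 : ∀ {n} → n ≡ 1 ⊎ n ≡ 2 → 𝟙 (n ≡ᵇ 1) + 2 * (n C 2) ≡ n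
𝟙[≡1]+2C2 (inj₁ refl) = refl
𝟙[≡1]+2C2 (inj₂ refl) = refl

module _ {ts rs} (!ts : Unique ts) (2≤ : 2 ≤ length ts) (p1 : P1 ts) (p2 : P2 ts) (p45 : P45 ts)
         (enum : RunEnumeration ts rs) where

  runsThrough-1-or-2 : ∀ {t} → t ∈ ts → runsThrough t rs ≡ 1 ⊎ runsThrough t rs ≡ 2
  runsThrough-1-or-2 t∈ =
    one-or-two (runsThrough-positive !ts 2≤ p1 (proj₁ (proj₂ enum)) t∈) (runsThrough≤2 p2 p45 enum)
    where
    one-or-two : ∀ {n} → 1 ≤ n → n ≤ 2 → n ≡ 1 ⊎ n ≡ 2
    one-or-two (s≤s z≤n) (s≤s z≤n)       = inj₁ refl
    one-or-two (s≤s z≤n) (s≤s (s≤s z≤n)) = inj₂ refl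

  tiles+edges : length ts + runGraphEdges rs ≡ 3 * length rs
  tiles+edges = begin
    length ts + runGraphEdges rs
      ≡⟨ cong₂ _+_ (sym (∑-1 ts)) (sym (∑-runsThrough-C2 !ts p2 p45 enum)) ⟩
    ∑[ t ∈ ts ] 1 + ∑[ t ∈ ts ] (runsThrough t rs C 2)
      ≡⟨ sym (∑-+ (λ _ → 1) (λ t → runsThrough t rs C 2) ts) ⟩
    ∑[ t ∈ ts ] (1 + runsThrough t rs C 2)
      ≡⟨ ∑-cong ts (1+C2 ∘ runsThrough-1-or-2) ⟩
    ∑[ t ∈ ts ] runsThrough t rs
      ≡⟨ ∑-runsThrough !ts p45 (proj₁ enum) ⟩
    3 * length rs
      ∎
    where open ≡-Reasoning

  leaves+2edges : leaves ts rs + 2 * runGraphEdges rs ≡ 3 * length rs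
  leaves+2edges = begin
    leaves ts rs + 2 * runGraphEdges rs
      ≡⟨ cong₂ _+_ (length-filterᵇ (λ t → runsThrough t rs ≡ᵇ 1) ts)
                   (trans (cong (2 *_) (sym (∑-runsThrough-C2 !ts p2 p45 enum)))
                          (sym (∑-*ˡ 2 (λ t → runsThrough t rs C 2) ts))) ⟩
    ∑[ t ∈ ts ] 𝟙 (runsThrough t rs ≡ᵇ 1) + ∑[ t ∈ ts ] (2 * (runsThrough t rs C 2))
      ≡⟨ sym (∑-+ (λ t → 𝟙 (runsThrough t rs ≡ᵇ 1)) (λ t → 2 * (runsThrough t rs C 2)) ts) ⟩
    ∑[ t ∈ ts ] (𝟙 (runsThrough t rs ≡ᵇ 1) + 2 * (runsThrough t rs C 2))
      ≡⟨ ∑-cong ts (𝟙[≡1]+2C2 ∘ runsThrough-1-or-2) ⟩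
    ∑[ t ∈ ts ] runsThrough t rs
      ≡⟨ ∑-runsThrough !ts p45 (proj₁ enum) ⟩
    3 * length rs
      ∎
    where open ≡-Reasoning

ℕ-sum⇒ℤ-difference : ∀ {a b c} → a + b ≡ c → + a ≡ + c - + b
ℕ-sum⇒ℤ-difference {a} {b} refl = sym (begin
  + (a + b) - + b  ≡⟨ ℤ.[+m]-[+n]≡m⊖n (a + b) b ⟩
  (a + b) ⊖ b      ≡⟨ ℤ.⊖-≥ (m≤n+m b a) ⟩
  + (a + b ∸ b)    ≡⟨ cong +_ (m+n∸n≡m a b) ⟩
  + a              ∎)
  where open ≡-Reasoning

lemma9 : (ts : List Tile) → Tredoku ts →
         (rs : List (List Tile)) → RunEnumeration ts rs →
         (+ length ts ≡ + (3 * length rs) - + runGraphEdges rs)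
         × (+ leaves ts rs ≡ + (3 * length rs) - + (2 * runGraphEdges rs))
lemma9 ts (!ts , 5≤ , p1 , p2 , _ , p45 , _) rs enum =
  ℕ-sum⇒ℤ-difference (tiles+edges !ts 2≤ p1 p2 p45 enum) ,
  ℕ-sum⇒ℤ-difference (leaves+2edges !ts 2≤ p1 p2 p45 enum)
  where
  2≤ : 2 ≤ length ts
  2≤ = ≤-trans (s≤s (s≤s z≤n)) 5≤
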